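{- For every store term $s$ and location $\ell$: if $\ell\in\mathrm{dom}(s)$ then there exists a value $V$ such that $\vdash\mathrm{lkp}_\ell(s)=V$.
   Context: Fix a countably infinite set $\mathbf{L}$ of locations. Values are the terms $V ::= x\mid\lambda x.M$ of an untyped calculus. Store terms $s ::= \mathrm{emp} \mid \mathrm{upd}_\ell(u,s)$ and lookup terms $u ::= V \mid \mathrm{lkp}_\ell(s)$ ($\ell\in\mathbf{L}$), where $\mathrm{lkp}_\ell(s)$ is well formed only if $\ell\in\mathrm{dom}(s)$; $\mathrm{dom}(\mathrm{emp})=\emptyset$, $\mathrm{dom}(\mathrm{upd}_\ell(u,s))=\{\ell\}\cup\mathrm{dom}(s)$. $\vdash a=b$ means the equation is derivable in equational logic (reflexivity, symmetry, transitivity, congruence) from: (1) $\mathrm{lkp}_\ell(\mathrm{upd}_\ell(u,s))=u$; (2) $\mathrm{lkp}_\ell(\mathrm{upd}_{\ell'}(u,s))=\mathrm{lkp}_\ell(s)$ if $\ell\neq\ell'$; (3) $\mathrm{upd}_\ell(\mathrm{lkp}_\ell(s),s)=s$; (4) $\mathrm{upd}_\ell(U,\mathrm{upd}_\ell(W,s))=\mathrm{upd}_\ell(U,s)$; (5) $\mathrm{upd}_\ell(U,\mathrm{upd}_{\ell'}(W,s))=\mathrm{upd}_{\ell'}(W,\mathrm{upd}_\ell(U,s))$ if $\ell\ne\ell'$ ($U,W$ values). -}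

module Defs where

open import Data.Nat using (ℕ)
open import Data.List using (List; []; _∷_)
open import Data.List.Membership.Propositional using (_∈_)
open import Data.Product using (_×_)
open import Data.Unit using (⊤)
open import Relation.Binary.PropositionalEquality using (_≢_)

Loc : Set
Loc = ℕ

Var : Set
Var = ℕ

data Term : Set where
  var : Var → Term
  lam : Var → Term → Term
  app : Term → Term → Term

data Value : Set where
  vvar : Var → Value
  vlam : Var → Term → Value

mutual
  data Store : Set where
    emp : Store
    upd : Loc → Lookup → Store → Store

  data Lookup : Set where
    val : Value → Lookup
    lkp : Loc → Store → Lookup

dom : Store → List Loc
dom emp = []
dom (upd ℓ u s) = ℓ ∷ dom s

mutual
  WFS : Store → Set
  WFS emp = ⊤
  WFS (upd ℓ u s) = WFU u × WFS s

  WFU : Lookup → Set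
  WFU (val V) = ⊤
  WFU (lkp ℓ s) = (ℓ ∈ dom s) × WFS s

-- Derivability (⊢ a = b) in equational logic from axioms (1)-(5), over well-formed terms:
-- s ≐s t  means ⊢ s = t for store terms, u ≐u v means ⊢ u = v for lookup terms.
mutual
  data _≐s_ : Store → Store → Set where
    s-refl  : ∀ {s} → WFS s → s ≐s s
    s-sym   : ∀ {s t} → s ≐s t → t ≐s s
    s-trans : ∀ {s t r} → s ≐s t → t ≐s r → s ≐s r
    s-upd   : ∀ {ℓ u u' s s'} → u ≐u u' → s ≐s s' → upd ℓ u s ≐s upd ℓ u' s'
    ax3 : ∀ {ℓ s} → WFS s → ℓ ∈ dom s → upd ℓ (lkp ℓ s) s ≐s s
    ax4 : ∀ {ℓ U W s} → WFS s → upd ℓ (val U) (upd ℓ (val W) s) ≐s upd ℓ (val U) s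
    ax5 : ∀ {ℓ ℓ' U W s} → ℓ ≢ ℓ' → WFS s →
          upd ℓ (val U) (upd ℓ' (val W) s) ≐s upd ℓ' (val W) (upd ℓ (val U) s)

  data _≐u_ : Lookup → Lookup → Set where
    u-refl  : ∀ {u} → WFU u → u ≐u u
    u-sym   : ∀ {u v} → u ≐u v → v ≐u u
    u-trans : ∀ {u v w} → u ≐u v → v ≐u w → u ≐u w
    u-lkp   : ∀ {ℓ s s'} → ℓ ∈ dom s → ℓ ∈ dom s' → s ≐s s' → lkp ℓ s ≐u lkp ℓ s'
    ax1 : ∀ {ℓ u s} → WFU u → WFS s → lkp ℓ (upd ℓ u s) ≐u u
    ax2 : ∀ {ℓ ℓ' u s} → ℓ ≢ ℓ' → WFU u → WFS s → ℓ ∈ dom s →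
          lkp ℓ (upd ℓ' u s) ≐u lkp ℓ s

  infix 4 _≐s_ _≐u_

module Submission where

open import Defs
open import Data.List.Membership.Propositional using (_∈_)
open import Data.List.Relation.Unary.Any using (here; there)
open import Data.Nat using (_≟_)
open import Data.Product using (∃; _,_; map₂)
open import Relation.Nullary using (yes; no; contradiction)
open import Relation.Binary.PropositionalEquality using (refl)

-- Every well-formed lookup term evaluates to a value, by mutual structural
-- induction: axioms (1) and (2) strip the outermost update of the store, and the
-- lookup term stored there is again a lookup into a strictly smaller store.

mutual
  lookup≐val : ∀ (u : Lookup) → WFU u → ∃ λ (V : Value) → u ≐u val V
  lookup≐val (val V)   _          = V , u-refl _
  lookup≐val (lkp ℓ s) (ℓ∈s , ws) = lkp≐val s ℓ ws ℓ∈s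

  lkp≐val : ∀ (s : Store) (ℓ : Loc) → WFS s → ℓ ∈ dom s →
    ∃ λ (V : Value) → lkp ℓ s ≐u val V
  lkp≐val (upd ℓ′ u s) ℓ (wu , ws) ℓ∈ with ℓ ≟ ℓ′ | ℓ∈
  ... | yes refl | _         = map₂ (u-trans (ax1 wu ws)) (lookup≐val u wu)
  ... | no ℓ≢ℓ′  | here ℓ≡ℓ′ = contradiction ℓ≡ℓ′ ℓ≢ℓ′
  ... | no ℓ≢ℓ′  | there ℓ∈s = map₂ (u-trans (ax2 ℓ≢ℓ′ wu ws ℓ∈s)) (lkp≐val s ℓ ws ℓ∈s)

mainTheorem8 : ∀ (s : Store) (ℓ : Loc) → WFS s → ℓ ∈ dom s →
    ∃ λ (V : Value) → lkp ℓ s ≐u val V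
mainTheorem8 = lkp≐val
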